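{- Define four families of polynomials $f^{(i)}(X), t^{(i)}(X), d^{(i)}(X), s^{(i)}(X)$ ($i \ge 0$) by the simultaneous recursions $$f^{(0)}(X)=1;\qquad t^{(i)}(X)=\sum_{j=0}^{i}\binom{i}{j}X^{i-j}f^{(j)}(X)\ (i\ge 0);\qquad d^{(i)}(X)=t^{(i)}(X)-X\,f^{(i)}(X)\ (i\ge 0);$$ $$s^{(i)}(X)=f^{(i)}(X)+d^{(i)}(X)\ (i\ge 0);\qquad f^{(i)}(X)=\sum_{j=0}^{i-1}\binom{i}{j}X^{i-1-j}s^{(j)}(X)\ (i\ge 1).$$ For a polynomial $h$, write $[X^j]h$ for the coefficient of $X^j$ in $h$. Then for every $i\ge 0$, $$[X^0]f^{(i)}=[X^0]t^{(i)}=[X^0]d^{(i)}=-[X^1]d^{(i)}=\tfrac12[X^0]s^{(i)}=2^i\, i!.$$ -}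

module Defs where

open import Data.Nat as ℕ using (ℕ; zero; suc; _≤?_)
open import Data.Nat.Combinatorics using (_C_)
open import Data.Integer as ℤ using (ℤ; +_; 0ℤ; 1ℤ)
open import Relation.Nullary using (yes; no)

-- Polynomials in ℤ[X], represented by their coefficient sequence:
-- p n is the coefficient [X^n] p.  (All polynomials below have finite
-- support; only addition, subtraction, integer scaling and multiplication
-- by powers of X are needed, which act coefficientwise.)
Poly : Set
Poly = ℕ → ℤ

coeff : ℕ → Poly → ℤ
coeff j h = h j

one : Poly
one zero    = 1ℤ
one (suc _) = 0ℤ

zeroP : Poly
zeroP _ = 0ℤ

_⊕_ : Poly → Poly → Poly
(p ⊕ q) n = p n ℤ.+ q n

_⊖_ : Poly → Poly → Poly
(p ⊖ q) n = p n ℤ.- q n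

_·_ : ℕ → Poly → Poly
(c · p) n = (+ c) ℤ.* p n

Xpow* : ℕ → Poly → Poly
Xpow* zero    p n       = p n
Xpow* (suc k) p zero    = 0ℤ
Xpow* (suc k) p (suc n) = Xpow* k p n

sumBelow : ℕ → (ℕ → Poly) → Poly
sumBelow zero    g = zeroP
sumBelow (suc n) g = sumBelow n g ⊕ g n

tOf : (ℕ → Poly) → ℕ → Poly
tOf f i = sumBelow (suc i) (λ j → (i C j) · Xpow* (i ℕ.∸ j) (f j))

dOf : (ℕ → Poly) → ℕ → Poly
dOf f i = tOf f i ⊖ Xpow* 1 (f i)

sOf : (ℕ → Poly) → ℕ → Poly
sOf f i = f i ⊕ dOf f i

-- fPrefix n k = f^(k) for all k ≤ n (values for k > n are irrelevant).
-- f^(0) = 1,  f^(i) = Σ_{j=0}^{i-1} C(i,j) X^{i-1-j} s^(j)  (i ≥ 1).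
fPrefix : ℕ → ℕ → Poly
fPrefix zero    k = one
fPrefix (suc n) k with k ≤? n
... | yes _ = fPrefix n k
... | no  _ = sumBelow (suc n)
                (λ j → (suc n C j) · Xpow* (n ℕ.∸ j) (sOf (fPrefix n) j))

f : ℕ → Poly
f i = fPrefix i i

t : ℕ → Poly
t = tOf f

d : ℕ → Poly
d = dOf f

s : ℕ → Poly
s = sOf f

-- Every family involved is a binomial sum Σ_{j≤n} c_j X^{n-j} g_j, whose constant coefficient
-- is c_n g_n(0) and whose linear coefficient is c_n g_n(1) + c_{n-1} g_{n-1}(0).  Hence
-- t(0) = d(0) = f(0), s(0) = 2 f(0) and f^(n+1)(0) = (n+1) s^(n)(0), so f^(n)(0) = 2^n n!.
-- One level up, the same expansion shows by induction that f^(n+1)(1) = -(n+1) f^(n)(0), and since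
-- d^(n)(1) = f^(n)(1) + n f^(n-1)(0) - f^(n)(0) this is exactly [X^1] d^(n) = -[X^0] f^(n).
module Submission where

open import Defs
open import Data.Nat using (ℕ; zero; suc; _+_; _*_; _^_; _!; _∸_; _≤_; _<_; _≤?_; s≤s; s≤s⁻¹)
open import Data.Nat.Properties
  using (≤-refl; ≤-trans; n∸n≡0; m+n∸n≡m; m+n≤o⇒m≤o∸n; m≤n⇒m≤1+n; m<n⇒m<1+n; 1+n≰n;
         m≤n⇒m<n∨m≡n; *-distribˡ-+)
open import Data.Nat.Combinatorics
  using (_C_; nCn≡1; nC1≡n; nCk≡nC[n∸k]; nCk+nC[k+1]≡[n+1]C[k+1])
import Data.Nat.Tactic.RingSolver as ℕ-Solver
open import Data.Integer as ℤ using (+_; -_; 0ℤ)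
open import Data.Integer.Properties using (+-comm; +-identityˡ; +-identityʳ; *-identityˡ; *-zeroʳ; pos-*)
import Data.Integer.Tactic.RingSolver as ℤ-Solver
open import Data.Product using (_×_; _,_)
open import Data.Sum using (inj₁; inj₂)
open import Relation.Nullary using (yes; no; contradiction)
open import Relation.Binary.PropositionalEquality
  using (_≡_; _≗_; refl; sym; trans; cong; cong₂; module ≡-Reasoning)

open ≡-Reasoning

n+n≡2*n : ∀ n → n + n ≡ 2 * n
n+n≡2*n = ℕ-Solver.solve-∀

[1+n]Cn≡1+n : ∀ n → suc n C n ≡ suc n
[1+n]Cn≡1+n n = begin
  suc n C n           ≡⟨ nCk≡nC[n∸k] (m≤n⇒m≤1+n (≤-refl {n})) ⟩
  suc n C (suc n ∸ n) ≡⟨ cong (suc n C_) (m+n∸n≡m 1 n) ⟩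
  suc n C 1           ≡⟨ nC1≡n (suc n) ⟩
  suc n               ∎

2*nC2≡n*[n∸1] : ∀ n → 2 * (n C 2) ≡ n * (n ∸ 1)
2*nC2≡n*[n∸1] zero          = refl
2*nC2≡n*[n∸1] (suc zero)    = refl
2*nC2≡n*[n∸1] (suc (suc k)) = begin
  2 * (suc (suc k) C 2)             ≡⟨ cong (2 *_) (nCk+nC[k+1]≡[n+1]C[k+1] (suc k) 1) ⟨
  2 * (suc k C 1 + suc k C 2)       ≡⟨ *-distribˡ-+ 2 (suc k C 1) (suc k C 2) ⟩
  2 * (suc k C 1) + 2 * (suc k C 2) ≡⟨ cong₂ (λ a b → 2 * a + b) (nC1≡n (suc k)) (2*nC2≡n*[n∸1] (suc k)) ⟩
  2 * suc k + suc k * k             ≡⟨ expand k ⟩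
  suc (suc k) * suc k               ∎
  where
  expand : ∀ k → 2 * suc k + suc k * k ≡ suc (suc k) * suc k
  expand = ℕ-Solver.solve-∀

2*[2+n]Cn≡[2+n]*[1+n] : ∀ n → 2 * (suc (suc n) C n) ≡ suc (suc n) * suc n
2*[2+n]Cn≡[2+n]*[1+n] n = begin
  2 * (suc (suc n) C n)                 ≡⟨ cong (2 *_) (nCk≡nC[n∸k] (m≤n⇒m≤1+n (m≤n⇒m≤1+n (≤-refl {n})))) ⟩
  2 * (suc (suc n) C (suc (suc n) ∸ n)) ≡⟨ cong (λ k → 2 * (suc (suc n) C k)) (m+n∸n≡m 2 n) ⟩
  2 * (suc (suc n) C 2)                 ≡⟨ 2*nC2≡n*[n∸1] (suc (suc n)) ⟩
  suc (suc n) * suc n                   ∎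

Xpow*-below : ∀ {k m} (p : Poly) → m < k → Xpow* k p m ≡ 0ℤ
Xpow*-below {suc k} {zero}  p _         = refl
Xpow*-below {suc k} {suc m} p (s≤s m<k) = Xpow*-below p m<k

Xpow*-cong : ∀ k {p q : Poly} → p ≗ q → Xpow* k p ≗ Xpow* k q
Xpow*-cong zero    p≗q m       = p≗q m
Xpow*-cong (suc k) _   zero    = refl
Xpow*-cong (suc k) p≗q (suc m) = Xpow*-cong k p≗q m

sumBelow-cong : ∀ n {g h : ℕ → Poly} → (∀ {j} → j < n → g j ≗ h j) → sumBelow n g ≗ sumBelow n h
sumBelow-cong zero    _   _ = refl
sumBelow-cong (suc n) g≗h m =
  cong₂ ℤ._+_ (sumBelow-cong n (λ j<n → g≗h (m<n⇒m<1+n j<n)) m) (g≗h ≤-refl m)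

sumBelow-vanishes : ∀ n {g : ℕ → Poly} m → (∀ {j} → j < n → g j m ≡ 0ℤ) → sumBelow n g m ≡ 0ℤ
sumBelow-vanishes zero    _ _   = refl
sumBelow-vanishes (suc n) m g≡0 =
  cong₂ ℤ._+_ (sumBelow-vanishes n m (λ j<n → g≡0 (m<n⇒m<1+n j<n))) (g≡0 ≤-refl)

·-Xpow*-below : ∀ c {k m} (p : Poly) → m < k → (c · Xpow* k p) m ≡ 0ℤ
·-Xpow*-below c p m<k = trans (cong (+ c ℤ.*_) (Xpow*-below p m<k)) (*-zeroʳ (+ c))

shiftSum : (ℕ → ℕ) → (ℕ → Poly) → ℕ → Poly
shiftSum c g n = sumBelow (suc n) (λ j → c j · Xpow* (n ∸ j) (g j))

shiftSum-cong : ∀ c n {g h : ℕ → Poly} → (∀ {j} → j ≤ n → g j ≗ h j) → shiftSum c g n ≗ shiftSum c h n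
shiftSum-cong c n g≗h = sumBelow-cong (suc n)
  (λ {j} j<1+n m → cong (+ c j ℤ.*_) (Xpow*-cong (n ∸ j) (g≗h (s≤s⁻¹ j<1+n)) m))

shiftSum-coeff₀ : ∀ c g n → shiftSum c g n 0 ≡ + c n ℤ.* g n 0
shiftSum-coeff₀ c g n = begin
  sumBelow n term 0 ℤ.+ + c n ℤ.* Xpow* (n ∸ n) (g n) 0
    ≡⟨ cong₂ ℤ._+_ (sumBelow-vanishes n 0 (λ {j} j<n → ·-Xpow*-below (c j) (g j) (m+n≤o⇒m≤o∸n 1 j<n)))
                   (cong (λ k → + c n ℤ.* Xpow* k (g n) 0) (n∸n≡0 n)) ⟩
  0ℤ ℤ.+ + c n ℤ.* g n 0
    ≡⟨ +-identityˡ (+ c n ℤ.* g n 0) ⟩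
  + c n ℤ.* g n 0 ∎
  where
  term : ℕ → Poly
  term j = c j · Xpow* (n ∸ j) (g j)

shiftSum-coeff₁ : ∀ c g n → shiftSum c g (suc n) 1 ≡ + c (suc n) ℤ.* g (suc n) 1 ℤ.+ + c n ℤ.* g n 0
shiftSum-coeff₁ c g n = begin
  (sumBelow n term 1 ℤ.+ + c n ℤ.* Xpow* (suc n ∸ n) (g n) 1)
    ℤ.+ + c (suc n) ℤ.* Xpow* (n ∸ n) (g (suc n)) 1
    ≡⟨ cong₂ ℤ._+_
         (cong₂ ℤ._+_ (sumBelow-vanishes n 1 (λ {j} j<n → ·-Xpow*-below (c j) (g j) (m+n≤o⇒m≤o∸n 2 (s≤s j<n))))
                      (cong (λ k → + c n ℤ.* Xpow* k (g n) 1) (m+n∸n≡m 1 n)))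
         (cong (λ k → + c (suc n) ℤ.* Xpow* k (g (suc n)) 1) (n∸n≡0 n)) ⟩
  (0ℤ ℤ.+ + c n ℤ.* g n 0) ℤ.+ + c (suc n) ℤ.* g (suc n) 1
    ≡⟨ cong (ℤ._+ (+ c (suc n) ℤ.* g (suc n) 1)) (+-identityˡ (+ c n ℤ.* g n 0)) ⟩
  + c n ℤ.* g n 0 ℤ.+ + c (suc n) ℤ.* g (suc n) 1
    ≡⟨ +-comm (+ c n ℤ.* g n 0) (+ c (suc n) ℤ.* g (suc n) 1) ⟩
  + c (suc n) ℤ.* g (suc n) 1 ℤ.+ + c n ℤ.* g n 0 ∎
  where
  term : ℕ → Poly
  term j = c j · Xpow* (suc n ∸ j) (g j)

tOf-cong : ∀ i {g h : ℕ → Poly} → (∀ {k} → k ≤ i → g k ≗ h k) → tOf g i ≗ tOf h i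
tOf-cong i = shiftSum-cong (i C_) i

sOf-cong : ∀ i {g h : ℕ → Poly} → (∀ {k} → k ≤ i → g k ≗ h k) → sOf g i ≗ sOf h i
sOf-cong i g≗h m =
  cong₂ ℤ._+_ (g≗h ≤-refl m) (cong₂ ℤ._-_ (tOf-cong i g≗h m) (Xpow*-cong 1 (g≗h ≤-refl) m))

tOf-coeff₀ : ∀ g i → tOf g i 0 ≡ g i 0
tOf-coeff₀ g i = begin
  tOf g i 0           ≡⟨ shiftSum-coeff₀ (i C_) g i ⟩
  + (i C i) ℤ.* g i 0 ≡⟨ cong (λ c → + c ℤ.* g i 0) (nCn≡1 i) ⟩
  + 1 ℤ.* g i 0       ≡⟨ *-identityˡ (g i 0) ⟩
  g i 0               ∎

tOf-coeff₁ : ∀ g n → tOf g (suc n) 1 ≡ g (suc n) 1 ℤ.+ + suc n ℤ.* g n 0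
tOf-coeff₁ g n = begin
  tOf g (suc n) 1
    ≡⟨ shiftSum-coeff₁ (suc n C_) g n ⟩
  + (suc n C suc n) ℤ.* g (suc n) 1 ℤ.+ + (suc n C n) ℤ.* g n 0
    ≡⟨ cong₂ (λ a b → + a ℤ.* g (suc n) 1 ℤ.+ + b ℤ.* g n 0) (nCn≡1 (suc n)) ([1+n]Cn≡1+n n) ⟩
  + 1 ℤ.* g (suc n) 1 ℤ.+ + suc n ℤ.* g n 0
    ≡⟨ cong (ℤ._+ (+ suc n ℤ.* g n 0)) (*-identityˡ (g (suc n) 1)) ⟩
  g (suc n) 1 ℤ.+ + suc n ℤ.* g n 0 ∎

dOf-coeff₀ : ∀ g i → dOf g i 0 ≡ g i 0
dOf-coeff₀ g i = trans (+-identityʳ (tOf g i 0)) (tOf-coeff₀ g i)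

sOf-coeff₀ : ∀ g i → sOf g i 0 ≡ g i 0 ℤ.+ g i 0
sOf-coeff₀ g i = cong (ℤ._+_ (g i 0)) (dOf-coeff₀ g i)

fPrefix-extend : ∀ {n k} → k ≤ n → fPrefix (suc n) k ≗ fPrefix n k
fPrefix-extend {n} {k} k≤n m with k ≤? n
... | yes _   = refl
... | no  k≰n = contradiction k≤n k≰n

fPrefix-stable : ∀ {n k} → k ≤ n → fPrefix n k ≗ f k
fPrefix-stable k≤n m with m≤n⇒m<n∨m≡n k≤n
... | inj₂ refl         = refl
... | inj₁ (s≤s k≤n-1) = trans (fPrefix-extend k≤n-1 m) (fPrefix-stable k≤n-1 m)

-- Defs computes earlier values of f through fPrefix n; fPrefix-stable identifies them with f.
f-recursion : ∀ n → f (suc n) ≗ shiftSum (suc n C_) s n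
f-recursion n m with suc n ≤? n
... | yes 1+n≤n = contradiction 1+n≤n 1+n≰n
... | no  _     = shiftSum-cong (suc n C_) n
  (λ {j} j≤n → sOf-cong j (λ k≤j → fPrefix-stable (≤-trans k≤j j≤n))) m

f-coeff₀-suc : ∀ n → f (suc n) 0 ≡ + suc n ℤ.* (f n 0 ℤ.+ f n 0)
f-coeff₀-suc n = begin
  f (suc n) 0                     ≡⟨ f-recursion n 0 ⟩
  shiftSum (suc n C_) s n 0       ≡⟨ shiftSum-coeff₀ (suc n C_) s n ⟩
  + (suc n C n) ℤ.* s n 0         ≡⟨ cong₂ (λ c x → + c ℤ.* x) ([1+n]Cn≡1+n n) (sOf-coeff₀ f n) ⟩
  + suc n ℤ.* (f n 0 ℤ.+ f n 0)  ∎

f-coeff₀ : ∀ n → f n 0 ≡ + (2 ^ n * n !)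
f-coeff₀ zero    = refl
f-coeff₀ (suc n) = begin
  f (suc n) 0                                   ≡⟨ f-coeff₀-suc n ⟩
  + suc n ℤ.* (f n 0 ℤ.+ f n 0)                ≡⟨ cong (λ x → + suc n ℤ.* (x ℤ.+ x)) (f-coeff₀ n) ⟩
  + suc n ℤ.* + (2 ^ n * n ! + 2 ^ n * n !)     ≡⟨ pos-* (suc n) (2 ^ n * n ! + 2 ^ n * n !) ⟨
  + (suc n * (2 ^ n * n ! + 2 ^ n * n !))       ≡⟨ cong +_ (regroup (2 ^ n) (n !) n) ⟩
  + (2 ^ suc n * suc n !)                       ∎
  where
  regroup : ∀ p q n → suc n * (p * q + p * q) ≡ 2 * p * (suc n * q)
  regroup = ℕ-Solver.solve-∀

f-coeff₁-suc-suc : ∀ n →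
  f (suc (suc n)) 1 ≡ + suc (suc n) ℤ.* s (suc n) 1 ℤ.+ + (suc (suc n) C n) ℤ.* s n 0
f-coeff₁-suc-suc n = begin
  f (suc (suc n)) 1
    ≡⟨ f-recursion (suc n) 1 ⟩
  shiftSum (suc (suc n) C_) s (suc n) 1
    ≡⟨ shiftSum-coeff₁ (suc (suc n) C_) s n ⟩
  + (suc (suc n) C suc n) ℤ.* s (suc n) 1 ℤ.+ + (suc (suc n) C n) ℤ.* s n 0
    ≡⟨ cong (λ c → + c ℤ.* s (suc n) 1 ℤ.+ + (suc (suc n) C n) ℤ.* s n 0) ([1+n]Cn≡1+n (suc n)) ⟩
  + suc (suc n) ℤ.* s (suc n) 1 ℤ.+ + (suc (suc n) C n) ℤ.* s n 0 ∎

[2+n]Cn-double : ∀ n x → + (suc (suc n) C n) ℤ.* (x ℤ.+ x) ≡ (+ suc (suc n) ℤ.* + suc n) ℤ.* x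
[2+n]Cn-double n x = begin
  + c ℤ.* (x ℤ.+ x)                ≡⟨ double (+ c) x ⟩
  (+ c ℤ.+ + c) ℤ.* x              ≡⟨ cong (λ k → + k ℤ.* x) (n+n≡2*n c) ⟩
  + (2 * c) ℤ.* x                  ≡⟨ cong (λ k → + k ℤ.* x) (2*[2+n]Cn≡[2+n]*[1+n] n) ⟩
  + (suc (suc n) * suc n) ℤ.* x    ≡⟨ cong (ℤ._* x) (pos-* (suc (suc n)) (suc n)) ⟩
  (+ suc (suc n) ℤ.* + suc n) ℤ.* x ∎
  where
  c = suc (suc n) C n
  double : ∀ c x → c ℤ.* (x ℤ.+ x) ≡ (c ℤ.+ c) ℤ.* x
  double = ℤ-Solver.solve-∀

f-coeff₁ : ∀ n → f (suc n) 1 ≡ - (+ suc n ℤ.* f n 0)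
f-coeff₁ zero    = refl
f-coeff₁ (suc n) = begin
  f (suc (suc n)) 1
    ≡⟨ f-coeff₁-suc-suc n ⟩
  p ℤ.* (f (suc n) 1 ℤ.+ (t (suc n) 1 ℤ.- f (suc n) 0)) ℤ.+ + (suc (suc n) C n) ℤ.* s n 0
    ≡⟨ cong₂ (λ u v → p ℤ.* (f (suc n) 1 ℤ.+ (u ℤ.- f (suc n) 0)) ℤ.+ + (suc (suc n) C n) ℤ.* v)
             (tOf-coeff₁ f n) (sOf-coeff₀ f n) ⟩
  p ℤ.* (f (suc n) 1 ℤ.+ ((f (suc n) 1 ℤ.+ q ℤ.* a) ℤ.- f (suc n) 0)) ℤ.+ + (suc (suc n) C n) ℤ.* (a ℤ.+ a)
    ≡⟨ cong₂ (λ u v → p ℤ.* (u ℤ.+ ((u ℤ.+ q ℤ.* a) ℤ.- f (suc n) 0)) ℤ.+ v)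
             (f-coeff₁ n) ([2+n]Cn-double n a) ⟩
  p ℤ.* (- (q ℤ.* a) ℤ.+ ((- (q ℤ.* a) ℤ.+ q ℤ.* a) ℤ.- f (suc n) 0)) ℤ.+ (p ℤ.* q) ℤ.* a
    ≡⟨ cong (λ u → p ℤ.* (- (q ℤ.* a) ℤ.+ ((- (q ℤ.* a) ℤ.+ q ℤ.* a) ℤ.- u)) ℤ.+ (p ℤ.* q) ℤ.* a)
            (f-coeff₀-suc n) ⟩
  p ℤ.* (- (q ℤ.* a) ℤ.+ ((- (q ℤ.* a) ℤ.+ q ℤ.* a) ℤ.- q ℤ.* (a ℤ.+ a))) ℤ.+ (p ℤ.* q) ℤ.* a
    ≡⟨ collect p q a ⟩
  - (p ℤ.* (q ℤ.* (a ℤ.+ a)))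
    ≡⟨ cong (λ u → - (p ℤ.* u)) (f-coeff₀-suc n) ⟨
  - (p ℤ.* f (suc n) 0) ∎
  where
  p = + suc (suc n)
  q = + suc n
  a = f n 0
  collect : ∀ p q a →
    p ℤ.* (- (q ℤ.* a) ℤ.+ ((- (q ℤ.* a) ℤ.+ q ℤ.* a) ℤ.- q ℤ.* (a ℤ.+ a))) ℤ.+ (p ℤ.* q) ℤ.* a
      ≡ - (p ℤ.* (q ℤ.* (a ℤ.+ a)))
  collect = ℤ-Solver.solve-∀

d-coeff₁ : ∀ n → - d n 1 ≡ f n 0
d-coeff₁ zero    = refl
d-coeff₁ (suc n) = begin
  - (t (suc n) 1 ℤ.- f (suc n) 0)                          ≡⟨ cong (λ u → - (u ℤ.- f (suc n) 0)) (tOf-coeff₁ f n) ⟩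
  - ((f (suc n) 1 ℤ.+ q ℤ.* f n 0) ℤ.- f (suc n) 0)        ≡⟨ cong (λ u → - ((u ℤ.+ q ℤ.* f n 0) ℤ.- f (suc n) 0)) (f-coeff₁ n) ⟩
  - ((- (q ℤ.* f n 0) ℤ.+ q ℤ.* f n 0) ℤ.- f (suc n) 0)    ≡⟨ cancel q (f n 0) (f (suc n) 0) ⟩
  f (suc n) 0                                               ∎
  where
  q = + suc n
  cancel : ∀ q a b → - ((- (q ℤ.* a) ℤ.+ q ℤ.* a) ℤ.- b) ≡ b
  cancel = ℤ-Solver.solve-∀

mainTheorem3 : (i : ℕ) →
    (coeff 0 (f i) ≡ + (2 ^ i * i !)) ×
    (coeff 0 (t i) ≡ + (2 ^ i * i !)) ×
    (coeff 0 (d i) ≡ + (2 ^ i * i !)) ×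
    (- coeff 1 (d i) ≡ + (2 ^ i * i !)) ×
    (coeff 0 (s i) ≡ + (2 * (2 ^ i * i !)))
mainTheorem3 i =
  f₀ , trans (tOf-coeff₀ f i) f₀ , trans (dOf-coeff₀ f i) f₀ , trans (d-coeff₁ i) f₀ , s₀
  where
  f₀ : f i 0 ≡ + (2 ^ i * i !)
  f₀ = f-coeff₀ i
  s₀ : s i 0 ≡ + (2 * (2 ^ i * i !))
  s₀ = begin
    s i 0                                ≡⟨ sOf-coeff₀ f i ⟩
    f i 0 ℤ.+ f i 0                      ≡⟨ cong (λ x → x ℤ.+ x) f₀ ⟩
    + (2 ^ i * i ! + 2 ^ i * i !)        ≡⟨ cong +_ (n+n≡2*n (2 ^ i * i !)) ⟩
    + (2 * (2 ^ i * i !))                ∎
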